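{- The following are equivalent: (a) there is a polynomial $Q$ such that every graph on $n$ vertices has a CS-separator of size at most $Q(n)$; (b) there is a polynomial $Q'$ such that every graph $G$ on $n$ vertices has a family of at most $Q'(n)$ cuts such that for every inclusion-maximal clique $K$ and every inclusion-maximal stable set $S$ of $G$ with $K\cap S=\emptyset$, some cut of the family separates $K$ and $S$.
   Context: A cut of a graph $G=(V,E)$ is a pair $(A,B)$ with $A\cup B=V$ and $A\cap B=\emptyset$; it separates a clique $K$ and a stable set $S$ if $K\subseteq A$ and $S\subseteq B$. A CS-separator of $G$ is a family of cuts such that for every clique $K$ and every stable set $S$ with $K\cap S=\emptyset$, some cut of the family separates $K$ and $S$. -}

module Defs where

open import Data.Nat using (ℕ; zero; suc; _+_; _*_; _≤_)
open import Data.Bool using (Bool; true; false)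
open import Data.Fin using (Fin)
open import Data.Fin.Subset using (Subset; _∈_; _∉_; _⊆_)
open import Data.List using (List; []; _∷_; length)
open import Data.List.Relation.Unary.Any using (Any)
open import Data.Product using (Σ; ∃; _×_; _,_)
open import Data.Sum using (_⊎_)
open import Relation.Binary.PropositionalEquality using (_≡_; _≢_)

record Graph (n : ℕ) : Set where
  field
    adj   : Fin n → Fin n → Bool
    sym   : ∀ x y → adj x y ≡ adj y x
    irrefl : ∀ x → adj x x ≡ false
open Graph public

module _ {n : ℕ} (G : Graph n) where
  IsClique : Subset n → Set
  IsClique K = ∀ x y → x ∈ K → y ∈ K → x ≢ y → adj G x y ≡ true

  IsStable : Subset n → Set
  IsStable S = ∀ x y → x ∈ S → y ∈ S → x ≢ y → adj G x y ≡ false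

  IsMaximalClique : Subset n → Set
  IsMaximalClique K = IsClique K × (∀ K′ → IsClique K′ → K ⊆ K′ → K′ ⊆ K)

  IsMaximalStable : Subset n → Set
  IsMaximalStable S = IsStable S × (∀ S′ → IsStable S′ → S ⊆ S′ → S′ ⊆ S)

Disjoint : ∀ {n} → Subset n → Subset n → Set
Disjoint K S = ∀ x → x ∈ K → x ∉ S

record Cut (n : ℕ) : Set where
  field
    A : Subset n
    B : Subset n
    cover    : ∀ x → x ∈ A ⊎ x ∈ B
    disjoint : ∀ x → x ∈ A → x ∉ B
open Cut public

Separates : ∀ {n} → Cut n → Subset n → Subset n → Set
Separates c K S = K ⊆ A c × S ⊆ B c

IsCSSeparator : ∀ {n} → Graph n → List (Cut n) → Set
IsCSSeparator G F = ∀ K S → IsClique G K → IsStable G S → Disjoint K S →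
  Any (λ c → Separates c K S) F

IsMaxCSSeparator : ∀ {n} → Graph n → List (Cut n) → Set
IsMaxCSSeparator G F = ∀ K S → IsMaximalClique G K → IsMaximalStable G S →
  Disjoint K S → Any (λ c → Separates c K S) F

-- Polynomials with natural-number coefficients, as coefficient lists
-- (constant coefficient first), evaluated by Horner's rule.
Poly : Set
Poly = List ℕ

eval : Poly → ℕ → ℕ
eval []       x = 0
eval (a ∷ as) x = a + x * eval as x

-- Extend a clique K and a disjoint stable set S to maximal ones K′ ⊇ K and S′ ⊇ S.
-- If K′ ∩ S′ = ∅, a cut of the maximal separator separates K′ and S′, hence K and S.
-- Otherwise K′ and S′ share a vertex v, and K and S are separated by the closed
-- neighbourhood N[v] when v ∈ K, and by the open neighbourhood N(v) when v ∉ K.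
-- So adding these 2n cuts to a separator for maximal pairs gives a CS-separator.
module Submission where

open import Defs renaming (sym to adj-sym)
open import Data.Bool using (Bool; true; false; not; _∨_)
open import Data.Bool.Properties using () renaming (_≟_ to _≟ᵇ_)
open import Data.Empty using (⊥; ⊥-elim)
open import Data.Fin using (Fin; _≟_)
open import Data.Fin.Properties using (all?; any?)
open import Data.Fin.Subset using (Subset; _∈_; _∉_; _⊆_; _∪_; ⁅_⁆)
open import Data.Fin.Subset.Properties using (_∈?_; x∈⁅x⁆; x∈⁅y⁆⇒x≡y; p⊆p∪q; q⊆p∪q; x∈p∪q⁻)
open import Data.List using (List; []; _∷_; _++_; length; map; allFin)
open import Data.List.Properties using (length-++; length-map; length-tabulate)
open import Data.List.Membership.Propositional as List using (lose)
open import Data.List.Membership.Propositional.Properties using (∈-allFin; ∈-map⁺)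
open import Data.List.Relation.Unary.Any as Any using (Any; here; there)
open import Data.List.Relation.Unary.Any.Properties using (++⁺ˡ; ++⁺ʳ)
open import Data.Nat using (ℕ; _+_; _*_; _≤_)
open import Data.Nat.Properties using (+-identityʳ; +-monoˡ-≤; module ≤-Reasoning)
open import Data.Nat.Tactic.RingSolver using (solve-∀)
open import Data.Product using (Σ; ∃; _×_; _,_; proj₁)
open import Data.Sum using (_⊎_; inj₁; inj₂)
open import Data.Vec using (tabulate)
open import Function using (_∘_; id)
open import Data.Vec.Properties using (lookup∘tabulate; []=⇒lookup; lookup⇒[]=)
open import Relation.Nullary using (Dec; yes; no; does; ¬?; _→-dec_; _×-dec_)
open import Relation.Binary.PropositionalEquality using (_≡_; _≢_; refl; sym; trans; cong; cong₂; module ≡-Reasoning)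

infixl 6 _+ₚ_

_+ₚ_ : Poly → Poly → Poly
[]      +ₚ q       = q
(a ∷ p) +ₚ []      = a ∷ p
(a ∷ p) +ₚ (b ∷ q) = (a + b) ∷ (p +ₚ q)

eval-+ₚ : ∀ p q x → eval (p +ₚ q) x ≡ eval p x + eval q x
eval-+ₚ []      q       x = refl
eval-+ₚ (a ∷ p) []      x = sym (+-identityʳ _)
eval-+ₚ (a ∷ p) (b ∷ q) x rewrite eval-+ₚ p q x = interchange a b x (eval p x) (eval q x)
  where
  interchange : ∀ a b x u v → a + b + x * (u + v) ≡ a + x * u + (b + x * v)
  interchange = solve-∀

twice : Poly
twice = 0 ∷ 2 ∷ []

eval-twice : ∀ n → eval twice n ≡ n + n
eval-twice = normalise
  where
  normalise : ∀ n → 0 + n * (2 + n * 0) ≡ n + n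
  normalise = solve-∀

∈-tabulate⁺ : ∀ {n} (f : Fin n → Bool) {x} → f x ≡ true → x ∈ tabulate f
∈-tabulate⁺ f {x} fx = lookup⇒[]= x _ (trans (lookup∘tabulate f x) fx)

∈-tabulate⁻ : ∀ {n} (f : Fin n → Bool) {x} → x ∈ tabulate f → f x ≡ true
∈-tabulate⁻ f {x} x∈ = trans (sym (lookup∘tabulate f x)) ([]=⇒lookup x∈)

cutOf : ∀ {n} → (Fin n → Bool) → Cut n
cutOf f = record
  { A        = tabulate f
  ; B        = tabulate (not ∘ f)
  ; cover    = covers
  ; disjoint = λ x x∈A x∈B → true≢not (∈-tabulate⁻ f x∈A) (∈-tabulate⁻ (not ∘ f) x∈B)
  }
  where
  covers : ∀ x → x ∈ tabulate f ⊎ x ∈ tabulate (not ∘ f)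
  covers x with f x in fx
  ... | true  = inj₁ (∈-tabulate⁺ f fx)
  ... | false = inj₂ (∈-tabulate⁺ (not ∘ f) (cong not fx))
  true≢not : ∀ {b} → b ≡ true → not b ≡ true → ⊥
  true≢not refl ()

cutOf-separates : ∀ {n} (f : Fin n → Bool) {K S} →
  (∀ {x} → x ∈ K → f x ≡ true) → (∀ {x} → x ∈ S → f x ≡ false) → Separates (cutOf f) K S
cutOf-separates f fK fS = (λ x∈K → ∈-tabulate⁺ f (fK x∈K)) , (λ x∈S → ∈-tabulate⁺ (not ∘ f) (cong not (fS x∈S)))

separates-⊆ : ∀ {n} {c : Cut n} {K K′ S S′} → K ⊆ K′ → S ⊆ S′ → Separates c K′ S′ → Separates c K S
separates-⊆ K⊆K′ S⊆S′ (K′⊆A , S′⊆B) = K′⊆A ∘ K⊆K′ , S′⊆B ∘ S⊆S′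

module _ {n : ℕ} (G : Graph n) where

  -- Cliques (b = true) and stable sets (b = false) are treated uniformly.
  Homogeneous : Bool → Subset n → Set
  Homogeneous b K = ∀ x y → x ∈ K → y ∈ K → x ≢ y → adj G x y ≡ b

  MaximalHomogeneous : Bool → Subset n → Set
  MaximalHomogeneous b K = Homogeneous b K × (∀ K′ → Homogeneous b K′ → K ⊆ K′ → K′ ⊆ K)

  Extends : Bool → Subset n → Fin n → Set
  Extends b K x = ∀ y → y ∈ K → y ≢ x → adj G x y ≡ b

  extends? : ∀ b K x → Dec (Extends b K x)
  extends? b K x = all? λ y → y ∈? K →-dec ¬? (y ≟ x) →-dec adj G x y ≟ᵇ b

  extends-antitone : ∀ {b K K′} x → K ⊆ K′ → Extends b K′ x → Extends b K x
  extends-antitone x K⊆K′ ext y y∈K = ext y (K⊆K′ y∈K)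

  homogeneous-∪-⁅⁆ : ∀ {b K} x → Homogeneous b K → Extends b K x → Homogeneous b (K ∪ ⁅ x ⁆)
  homogeneous-∪-⁅⁆ {b} {K} x hom ext u w u∈ w∈ u≢w with x∈p∪q⁻ K ⁅ x ⁆ u∈ | x∈p∪q⁻ K ⁅ x ⁆ w∈
  ... | inj₁ u∈K | inj₁ w∈K = hom u w u∈K w∈K u≢w
  ... | inj₁ u∈K | inj₂ w∈x rewrite x∈⁅y⁆⇒x≡y x w∈x = trans (adj-sym G u x) (ext u u∈K u≢w)
  ... | inj₂ u∈x | inj₁ w∈K rewrite x∈⁅y⁆⇒x≡y x u∈x = ext w w∈K (λ w≡x → u≢w (sym w≡x))
  ... | inj₂ u∈x | inj₂ w∈x = ⊥-elim (u≢w (trans (x∈⁅y⁆⇒x≡y x u∈x) (sym (x∈⁅y⁆⇒x≡y x w∈x))))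

  saturate : ∀ b (xs : List (Fin n)) K → Homogeneous b K →
    Σ (Subset n) λ K′ → K ⊆ K′ × Homogeneous b K′ ×
      (∀ x → x List.∈ xs → x ∉ K′ → Extends b K′ x → ⊥)
  saturate b []       K hom = K , (λ x∈K → x∈K) , hom , λ _ ()
  saturate b (x ∷ xs) K hom with extends? b K x
  ... | yes ext with saturate b xs (K ∪ ⁅ x ⁆) (homogeneous-∪-⁅⁆ x hom ext)
  ...   | K′ , K∪x⊆K′ , hom′ , stuck = K′ , (λ y∈K → K∪x⊆K′ (p⊆p∪q ⁅ x ⁆ y∈K)) , hom′ , stuck′
    where
    stuck′ : ∀ y → y List.∈ x ∷ xs → y ∉ K′ → Extends b K′ y → ⊥
    stuck′ y (here refl) y∉K′ _ = y∉K′ (K∪x⊆K′ (q⊆p∪q K ⁅ x ⁆ (x∈⁅x⁆ x)))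
    stuck′ y (there y∈xs) = stuck y y∈xs
  saturate b (x ∷ xs) K hom | no ¬ext with saturate b xs K hom
  ...   | K′ , K⊆K′ , hom′ , stuck = K′ , K⊆K′ , hom′ , stuck′
    where
    stuck′ : ∀ y → y List.∈ x ∷ xs → y ∉ K′ → Extends b K′ y → ⊥
    stuck′ y (here refl) _ ext = ¬ext (extends-antitone y K⊆K′ ext)
    stuck′ y (there y∈xs) = stuck y y∈xs

  extend-maximal : ∀ b K → Homogeneous b K →
    Σ (Subset n) λ K′ → K ⊆ K′ × MaximalHomogeneous b K′
  extend-maximal b K hom with saturate b (allFin n) K hom
  ... | K′ , K⊆K′ , hom′ , stuck = K′ , K⊆K′ , hom′ , maximal
    where
    maximal : ∀ K″ → Homogeneous b K″ → K′ ⊆ K″ → K″ ⊆ K′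
    maximal K″ hom″ K′⊆K″ {x} x∈K″ with x ∈? K′
    ... | yes x∈K′ = x∈K′
    ... | no x∉K′ = ⊥-elim (stuck x (∈-allFin x) x∉K′
            λ y y∈K′ y≢x → hom″ x y x∈K″ (K′⊆K″ y∈K′) (λ x≡y → y≢x (sym x≡y)))

  stable-nonadjacent : ∀ {S v x} → IsStable G S → v ∈ S → x ∈ S → adj G v x ≡ false
  stable-nonadjacent {v = v} {x} stable v∈S x∈S with v ≟ x
  ... | yes refl = irrefl G v
  ... | no v≢x = stable v x v∈S x∈S v≢x

  neighbourhoodCut : Fin n → Cut n
  neighbourhoodCut v = cutOf (adj G v)

  closedNeighbourhoodCut : Fin n → Cut n
  closedNeighbourhoodCut v = cutOf (λ x → does (x ≟ v) ∨ adj G v x)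

  vertexCuts : List (Cut n)
  vertexCuts = map neighbourhoodCut (allFin n) ++ map closedNeighbourhoodCut (allFin n)

  length-vertexCuts : length vertexCuts ≡ n + n
  length-vertexCuts = begin
    length vertexCuts
      ≡⟨ length-++ (map neighbourhoodCut (allFin n)) ⟩
    length (map neighbourhoodCut (allFin n)) + length (map closedNeighbourhoodCut (allFin n))
      ≡⟨ cong₂ _+_ (length-map neighbourhoodCut (allFin n)) (length-map closedNeighbourhoodCut (allFin n)) ⟩
    length (allFin n) + length (allFin n)
      ≡⟨ cong₂ _+_ (length-tabulate {n = n} id) (length-tabulate {n = n} id) ⟩
    n + n ∎
    where open ≡-Reasoning

  separated-by-vertexCut : ∀ {K S K′ S′ v} → IsClique G K → Disjoint K S →
    K ⊆ K′ → IsClique G K′ → S ⊆ S′ → IsStable G S′ → v ∈ K′ → v ∈ S′ →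
    Any (λ c → Separates c K S) vertexCuts
  separated-by-vertexCut {K} {S} {v = v} clique disjoint K⊆K′ clique′ S⊆S′ stable′ v∈K′ v∈S′
    with v ∈? K
  ... | yes v∈K = ++⁺ʳ (map neighbourhoodCut (allFin n))
        (lose (∈-map⁺ closedNeighbourhoodCut (∈-allFin v)) (cutOf-separates _ inK inS))
    where
    inK : ∀ {x} → x ∈ K → does (x ≟ v) ∨ adj G v x ≡ true
    inK {x} x∈K with x ≟ v
    ... | yes _ = refl
    ... | no x≢v = clique v x v∈K x∈K (x≢v ∘ sym)
    inS : ∀ {x} → x ∈ S → does (x ≟ v) ∨ adj G v x ≡ false
    inS {x} x∈S with x ≟ v
    ... | yes refl = ⊥-elim (disjoint x v∈K x∈S)
    ... | no _ = stable-nonadjacent stable′ v∈S′ (S⊆S′ x∈S)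
  ... | no v∉K = ++⁺ˡ (lose (∈-map⁺ neighbourhoodCut (∈-allFin v)) (cutOf-separates _ inK inS))
    where
    inK : ∀ {x} → x ∈ K → adj G v x ≡ true
    inK x∈K = clique′ _ _ v∈K′ (K⊆K′ x∈K) λ { refl → v∉K x∈K }
    inS : ∀ {x} → x ∈ S → adj G v x ≡ false
    inS x∈S = stable-nonadjacent stable′ v∈S′ (S⊆S′ x∈S)

  maxCSSeparator⇒CSSeparator : ∀ {F} → IsMaxCSSeparator G F → IsCSSeparator G (F ++ vertexCuts)
  maxCSSeparator⇒CSSeparator {F} separator K S clique stable disjoint
    with extend-maximal true K clique | extend-maximal false S stable
  ... | K′ , K⊆K′ , maxK′ | S′ , S⊆S′ , maxS′ with any? (λ v → v ∈? K′ ×-dec v ∈? S′)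
  ... | yes (v , v∈K′ , v∈S′) = ++⁺ʳ F
        (separated-by-vertexCut clique disjoint K⊆K′ (proj₁ maxK′) S⊆S′ (proj₁ maxS′) v∈K′ v∈S′)
  ... | no ¬common = ++⁺ˡ (Any.map (λ {c} → separates-⊆ {c = c} K⊆K′ S⊆S′)
        (separator K′ S′ maxK′ maxS′ λ v v∈K′ v∈S′ → ¬common (v , v∈K′ , v∈S′)))

CSSeparator⇒maxCSSeparator : ∀ {n} {G : Graph n} {F} → IsCSSeparator G F → IsMaxCSSeparator G F
CSSeparator⇒maxCSSeparator separator K S (clique , _) (stable , _) = separator K S clique stable

SeparatorsPolynomiallyBounded : (∀ {n} → Graph n → List (Cut n) → Set) → Set
SeparatorsPolynomiallyBounded IsSeparator =
  ∃ λ (Q : Poly) → ∀ (n : ℕ) (G : Graph n) → ∃ λ (F : List (Cut n)) → IsSeparator G F × length F ≤ eval Q n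

CS⇒maxCS : SeparatorsPolynomiallyBounded IsCSSeparator → SeparatorsPolynomiallyBounded IsMaxCSSeparator
CS⇒maxCS (Q , small) = Q , λ n G → let F , separator , bound = small n G in
  F , CSSeparator⇒maxCSSeparator {G = G} separator , bound

maxCS⇒CS : SeparatorsPolynomiallyBounded IsMaxCSSeparator → SeparatorsPolynomiallyBounded IsCSSeparator
maxCS⇒CS (Q′ , small) = Q′ +ₚ twice , λ n G → let F , separator , bound = small n G in
  F ++ vertexCuts G , maxCSSeparator⇒CSSeparator G separator , length-bound n G F bound
  where
  length-bound : ∀ n (G : Graph n) F → length F ≤ eval Q′ n → length (F ++ vertexCuts G) ≤ eval (Q′ +ₚ twice) n
  length-bound n G F bound = begin
    length (F ++ vertexCuts G)        ≡⟨ length-++ F ⟩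
    length F + length (vertexCuts G)  ≡⟨ cong (length F +_) (length-vertexCuts G) ⟩
    length F + (n + n)                ≤⟨ +-monoˡ-≤ (n + n) bound ⟩
    eval Q′ n + (n + n)               ≡⟨ cong (eval Q′ n +_) (eval-twice n) ⟨
    eval Q′ n + eval twice n          ≡⟨ eval-+ₚ Q′ twice n ⟨
    eval (Q′ +ₚ twice) n              ∎
    where open ≤-Reasoning

proposition2 : ((∃ λ (Q : Poly) → ∀ (n : ℕ) (G : Graph n) →
    ∃ λ (F : List (Cut n)) → IsCSSeparator G F × length F ≤ eval Q n)
    → (∃ λ (Q′ : Poly) → ∀ (n : ℕ) (G : Graph n) →
    ∃ λ (F : List (Cut n)) → IsMaxCSSeparator G F × length F ≤ eval Q′ n))
    × ((∃ λ (Q′ : Poly) → ∀ (n : ℕ) (G : Graph n) →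
    ∃ λ (F : List (Cut n)) → IsMaxCSSeparator G F × length F ≤ eval Q′ n)
    → (∃ λ (Q : Poly) → ∀ (n : ℕ) (G : Graph n) →
    ∃ λ (F : List (Cut n)) → IsCSSeparator G F × length F ≤ eval Q n))
proposition2 = CS⇒maxCS , maxCS⇒CS
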